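{- Let $G=(V,E)$ be a finite graph with maximum degree at most $2$ and let $n\geq 1$ be an integer. Let $A$ be an independent set in $G$ of size at most $n-1$ that is contained in the union of all connected components of $G$ that are paths. Then $C(\mathrm{lk}(I_n(G),A))\leq 2(n-1)-|A|$.
   Context: For a graph $G=(V,E)$, $I_n(G)=\{U\subseteq V:\ \alpha(G[U])<n\}$, where $\alpha$ is the independence number. For a simplicial complex $X$ and a set $\tau$, $\mathrm{lk}(X,\tau)=\{\sigma\in X:\ \sigma\cap\tau=\emptyset,\ \sigma\cup\tau\in X\}$. For a finite simplicial complex $X$, a face $\sigma$ contained in a unique maximal face $\tau$ is a free face; if $|\sigma|\leq d$, removing all faces $\eta$ with $\sigma\subseteq\eta\subseteq\tau$ is an elementary $d$-collapse. $X$ is $d$-collapsible if a sequence of elementary $d$-collapses reduces it to the void complex (no faces at all). $C(X)$ is the minimum $d$ such that $X$ is $d$-collapsible. -}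

module Defs where

open import Data.Nat using (ℕ; zero; suc; _≤_; _<_; _*_; _∸_)
open import Data.Bool using (Bool; true; false)
open import Data.Fin using (Fin; toℕ)
open import Data.Fin.Subset using (Subset; _∈_; _⊆_; _∩_; _∪_; ⊥; ∣_∣)
open import Data.Vec using (tabulate)
open import Data.Product using (Σ; ∃; ∃-syntax; _×_; _,_)
open import Data.Sum using (_⊎_)
open import Relation.Binary.PropositionalEquality using (_≡_)
open import Relation.Nullary using (¬_)
open import Function using (Injective)
open import Function.Bundles using (_⇔_)

record Graph (N : ℕ) : Set where
  field
    E      : Fin N → Fin N → Bool
    sym    : ∀ u v → E u v ≡ E v u
    irrefl : ∀ v → E v v ≡ false
open Graph public

module _ {N : ℕ} (G : Graph N) where

  nbhd : Fin N → Subset N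
  nbhd v = tabulate (λ u → E G v u)

  degree : Fin N → ℕ
  degree v = ∣ nbhd v ∣

  MaxDegreeAtMost2 : Set
  MaxDegreeAtMost2 = ∀ v → degree v ≤ 2

  Independent : Subset N → Set
  Independent S = ∀ u v → u ∈ S → v ∈ S → E G u v ≡ false

  -- α(G[U]) < n : every independent set of G[U] (= independent subset of U)
  -- has size < n, i.e. the maximum size of such a set is < n.
  IndepNumberLess : Subset N → ℕ → Set
  IndepNumberLess U n = ∀ S → S ⊆ U → Independent S → ∣ S ∣ < n

  I : ℕ → Subset N → Set
  I n U = IndepNumberLess U n

  data Reach (v : Fin N) : Fin N → Set where
    here : Reach v v
    step : ∀ {u w} → Reach v u → E G u w ≡ true → Reach v w

  ComponentIsPath : Fin N → Set
  ComponentIsPath v =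
    ∃[ k ] Σ (Fin (suc k) → Fin N) λ f →
      Injective _≡_ _≡_ f ×
      (∀ u → Reach v u ⇔ (∃[ i ] f i ≡ u)) ×
      (∀ i j → (E G (f i) (f j) ≡ true) ⇔ (toℕ i ≡ suc (toℕ j) ⊎ toℕ j ≡ suc (toℕ i)))

Complex : ℕ → Set₁
Complex N = Subset N → Set

module _ {N : ℕ} where

  lk : Complex N → Subset N → Complex N
  lk X τ σ = ((σ ∩ τ) ≡ ⊥) × X (σ ∪ τ)

  FreeFace : Complex N → Subset N → Subset N → Set
  FreeFace X σ τ = X σ × X τ × σ ⊆ τ × (∀ η → X η → σ ⊆ η → η ⊆ τ)

  removeInterval : Complex N → Subset N → Subset N → Complex N
  removeInterval X σ τ η = X η × ¬ (σ ⊆ η × η ⊆ τ)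

  Void : Complex N → Set
  Void X = ∀ η → ¬ X η

  data Collapsible (d : ℕ) : Complex N → Set₁ where
    done : ∀ {X} → Void X → Collapsible d X
    collapse : ∀ {X} σ τ → FreeFace X σ τ → ∣ σ ∣ ≤ d →
               Collapsible d (removeInterval X σ τ) → Collapsible d X

  CollapsibilityAtMost : Complex N → ℕ → Set₁
  CollapsibilityAtMost X m = ∃[ d ] (d ≤ m × Collapsible d X)

module Submission where

-- Generalise lk(I_n(G), A) to Lk W A n, the complex of all σ ⊆ W ∖ A with α(G[σ ∪ A]) < n, and show
-- C(Lk W A n) ≤ 2(n-1) - |A| whenever every vertex of A lies in a path component of G[W], by induction
-- on |W| + |W ∖ A|.  An end vertex a ∈ A of its path is peeled off, together with its neighbour if
-- that lies in A: this lowers n by one and |A| by at most two.  Otherwise split at a vertex u ∉ A that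
-- is an end vertex or the neighbour of an end vertex in A, using C(X) ≤ max(C(X ∖ u), C(lk(X, u)) + 1);
-- the two sides are Lk (W - u) A n and Lk W (A ∪ {u}) n and again satisfy the invariant.  If G[W] has
-- no end vertices it is a union of cycles and A = ∅; splitting at the successive vertices of a cycle
-- grows A along it until the one remaining vertex x of the cycle is the apex of a cone, and a cone
-- collapses as its deletion at x does.

open import Defs renaming (sym to E-sym)
open import Data.Nat using (ℕ; zero; suc; _≤_; _<_; _*_; _∸_; _+_; z≤n; s≤s; s≤s⁻¹; _≤?_; ⌈_/2⌉)
open import Data.Nat.Properties hiding (_≟_)
open import Data.Nat.Induction using (<-wellFounded)
open import Induction.WellFounded using (Acc; acc)
open import Data.Bool using (true; false)
import Data.Bool as Bool
open import Data.Fin using (Fin; zero; suc; toℕ; _≟_)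
open import Data.Fin.Properties using (any?; toℕ-injective)
open import Data.Fin.Subset using (Subset; _∈_; _∉_; _⊆_; _∪_; _∩_; _─_; _-_; ⊥; ⊤; ⁅_⁆; ∣_∣; Nonempty; Empty; inside; outside)
open import Data.Fin.Subset.Properties renaming (x∈p∧x≢y⇒x∈p-y to x∈p-y⁺)
open import Data.Vec using (_∷_; here; there)
open import Data.Vec.Properties using (lookup∘tabulate; []=⇒lookup; lookup⇒[]=)
open import Data.List using (List; []; _∷_; _∷ʳ_; length; initLast; _∷ʳ′_)
open import Data.List.Properties using (length-++)
open import Data.List.Membership.Propositional using () renaming (_∈_ to _∈ₗ_; _∉_ to _∉ₗ_)
open import Data.List.Relation.Unary.Any using (here; there)
open import Data.List.Relation.Unary.All as All using ([])
open import Data.List.Relation.Unary.All.Properties using (++⁻ˡ; ¬Any⇒All¬)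
open import Data.List.Relation.Unary.AllPairs using ([]; _∷_)
open import Data.List.Relation.Unary.Unique.Propositional using (Unique)
open import Data.List.Relation.Unary.Unique.Propositional.Properties using (Unique[x∷xs]⇒x∉xs)
open import Data.List.Membership.Propositional.Properties using (∈-++⁺ˡ; ∈-++⁺ʳ; ∈-++⁻)
open import Data.Product using (∃-syntax; _×_; _,_; proj₁; proj₂)
open import Data.Sum using (_⊎_; inj₁; inj₂; [_,_]′)
open import Data.Unit using (tt) renaming (⊤ to Unit)
open import Data.Empty using (⊥-elim)
open import Function.Bundles using (Equivalence)
open import Relation.Binary.PropositionalEquality using (_≡_; _≢_; refl; sym; trans; cong; subst; subst₂; module ≡-Reasoning)
open import Relation.Nullary using (¬_; Dec; yes; no)
open import Relation.Nullary.Decidable using (_×-dec_)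

private
  variable
    n : ℕ
    x y : Fin n
    p q r : Subset n

infix 4 _⊆_∖_
_⊆_∖_ : Subset n → Subset n → Subset n → Set
σ ⊆ W ∖ A = ∀ {x} → x ∈ σ → x ∈ W × x ∉ A

x∈p─q⇒x∉q : x ∈ p ─ q → x ∉ q
x∈p─q⇒x∉q {p = _ ∷ _} {inside ∷ _} () here
x∈p─q⇒x∉q {p = _ ∷ _} {outside ∷ _} here ()
x∈p─q⇒x∉q {p = _ ∷ _} {_ ∷ _} (there x∈) (there x∈q) = x∈p─q⇒x∉q x∈ x∈q

x∈p-y⁻ : x ∈ p - y → x ∈ p × x ≢ y
x∈p-y⁻ {x = x} {p = p} {y = y} x∈ =
  p─q⊆p p ⁅ y ⁆ x∈ , λ { refl → x∈p─q⇒x∉q {p = p} x∈ (x∈⁅x⁆ x) }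

y∉p-y : y ∉ p - y
y∉p-y y∈ = proj₂ (x∈p-y⁻ y∈) refl

∈∪⁻ : x ∈ p ∪ q → x ∈ p ⊎ x ∈ q
∈∪⁻ {p = p} {q} = x∈p∪q⁻ p q

∈∪ˡ : x ∈ p → x ∈ p ∪ q
∈∪ˡ x∈ = x∈p∪q⁺ (inj₁ x∈)

∈∪ʳ : x ∈ q → x ∈ p ∪ q
∈∪ʳ x∈ = x∈p∪q⁺ (inj₂ x∈)

∪-least : p ⊆ r → q ⊆ r → p ∪ q ⊆ r
∪-least p⊆ q⊆ x∈ = [ p⊆ , q⊆ ]′ (∈∪⁻ x∈)

∈⁅⁆⁻ : x ∈ ⁅ y ⁆ → x ≡ y
∈⁅⁆⁻ {y = y} = x∈⁅y⁆⇒x≡y y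

∈⁅⁆⁺ : x ≡ y → x ∈ ⁅ y ⁆
∈⁅⁆⁺ {x = x} refl = x∈⁅x⁆ x

∈∪⁅⁆ : x ∈ p ∪ ⁅ x ⁆
∈∪⁅⁆ {x = x} = ∈∪ʳ (x∈⁅x⁆ x)

∈∪⁅⁆⁻ : x ∈ p ∪ ⁅ y ⁆ → x ≢ y → x ∈ p
∈∪⁅⁆⁻ x∈ x≢y = [ (λ x∈p → x∈p) , (λ x∈y → ⊥-elim (x≢y (∈⁅⁆⁻ x∈y))) ]′ (∈∪⁻ x∈)

∪⁅⁆-mono : p ⊆ q → p ∪ ⁅ x ⁆ ⊆ q ∪ ⁅ x ⁆
∪⁅⁆-mono p⊆q = ∪-least (λ x∈ → ∈∪ˡ (p⊆q x∈)) ∈∪ʳ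

∪⁅⁆-⊆ : p ⊆ q → x ∈ q → p ∪ ⁅ x ⁆ ⊆ q
∪⁅⁆-⊆ p⊆q x∈q = ∪-least p⊆q (λ y∈ → subst (_∈ _) (sym (∈⁅⁆⁻ y∈)) x∈q)

∪⁅⁆-⊆∖ : ∀ {σ W A : Subset n} → σ ⊆ W ∖ A → x ∈ W → x ∉ A → σ ∪ ⁅ x ⁆ ⊆ W ∖ A
∪⁅⁆-⊆∖ {x = x} {W = W} {A} σ⊆ x∈W x∉A y∈ =
  [ σ⊆ , (λ y∈x → subst (λ z → z ∈ W × z ∉ A) (sym (∈⁅⁆⁻ y∈x)) (x∈W , x∉A)) ]′ (∈∪⁻ y∈)

p-x⊆p : p - x ⊆ p
p-x⊆p x∈ = proj₁ (x∈p-y⁻ x∈)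

p⊆q⇒p-x⊆q-x : p ⊆ q → p - x ⊆ q - x
p⊆q⇒p-x⊆q-x p⊆q y∈ = x∈p-y⁺ (p⊆q (p-x⊆p y∈)) (proj₂ (x∈p-y⁻ y∈))

p⊆q∧x∉p⇒p⊆q-x : p ⊆ q → x ∉ p → p ⊆ q - x
p⊆q∧x∉p⇒p⊆q-x p⊆q x∉ y∈ = x∈p-y⁺ (p⊆q y∈) λ { refl → x∉ y∈ }

p-x∪⁅x⁆≡p : x ∈ p → (p - x) ∪ ⁅ x ⁆ ≡ p
p-x∪⁅x⁆≡p {p = inside ∷ p} here = cong (inside ∷_) (trans (∪-identityʳ (p ─ ⊥)) (p─⊥≡p p))
p-x∪⁅x⁆≡p {p = inside ∷ _} (there x∈) = cong (inside ∷_) (p-x∪⁅x⁆≡p x∈)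
p-x∪⁅x⁆≡p {p = outside ∷ _} (there x∈) = cong (outside ∷_) (p-x∪⁅x⁆≡p x∈)

x∉p⇒p-x≡p : x ∉ p → p - x ≡ p
x∉p⇒p-x≡p {x = zero} {p = inside ∷ _} x∉ = ⊥-elim (x∉ here)
x∉p⇒p-x≡p {x = zero} {p = outside ∷ p} _ = cong (outside ∷_) (p─⊥≡p p)
x∉p⇒p-x≡p {x = suc _} {p = s ∷ _} x∉ = cong (s ∷_) (x∉p⇒p-x≡p (λ x∈ → x∉ (there x∈)))

∣p∣≡1+∣p-x∣ : x ∈ p → ∣ p ∣ ≡ suc ∣ p - x ∣
∣p∣≡1+∣p-x∣ {p = inside ∷ p} here = cong suc (cong ∣_∣ (sym (p─⊥≡p p)))
∣p∣≡1+∣p-x∣ {p = inside ∷ _} (there x∈) = cong suc (∣p∣≡1+∣p-x∣ x∈)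
∣p∣≡1+∣p-x∣ {p = outside ∷ _} (there x∈) = ∣p∣≡1+∣p-x∣ x∈

∣p∣≤1+∣p-x∣ : ∀ (x : Fin n) p → ∣ p ∣ ≤ suc ∣ p - x ∣
∣p∣≤1+∣p-x∣ x p with x ∈? p
... | yes x∈ = ≤-reflexive (∣p∣≡1+∣p-x∣ x∈)
... | no x∉ = m≤n⇒m≤1+n (p⊆q⇒∣p∣≤∣q∣ (p⊆q∧x∉p⇒p⊆q-x (λ y∈ → y∈) x∉))

∣p∪⁅x⁆∣≡1+∣p∣ : x ∉ p → ∣ p ∪ ⁅ x ⁆ ∣ ≡ suc ∣ p ∣
∣p∪⁅x⁆∣≡1+∣p∣ {x = x} {p = p} x∉ = trans (∣p∣≡1+∣p-x∣ {p = p ∪ ⁅ x ⁆} ∈∪⁅⁆) (cong (λ s → suc ∣ s ∣) p∪x-x≡p)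
  where
  p∪x-x≡p : (p ∪ ⁅ x ⁆) - x ≡ p
  p∪x-x≡p = ⊆-antisym (λ y∈ → ∈∪⁅⁆⁻ (p-x⊆p y∈) (proj₂ (x∈p-y⁻ y∈))) (p⊆q∧x∉p⇒p⊆q-x ∈∪ˡ x∉)

0<∣p∣⇒Nonempty : 0 < ∣ p ∣ → Nonempty p
0<∣p∣⇒Nonempty {p = inside ∷ _} _ = zero , here
0<∣p∣⇒Nonempty {p = outside ∷ p} 0<∣p∣ with 0<∣p∣⇒Nonempty {p = p} 0<∣p∣
... | x , x∈ = suc x , there x∈

Empty⇒∣p∣≡0 : Empty p → ∣ p ∣ ≡ 0
Empty⇒∣p∣≡0 {n} empty = trans (cong ∣_∣ (Empty-unique empty)) (∣⊥∣≡0 n)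

∣p∣≤1 : (∀ {x y} → x ∈ p → y ∈ p → x ≡ y) → ∣ p ∣ ≤ 1
∣p∣≤1 {p = p} unique with ∣ p ∣ ≤? 0
... | yes ∣p∣≤0 = m≤n⇒m≤1+n ∣p∣≤0
... | no ∣p∣≰0 with 0<∣p∣⇒Nonempty {p = p} (≰⇒> ∣p∣≰0)
... | x , x∈ = ≤-trans (p⊆q⇒∣p∣≤∣q∣ (λ y∈ → ∈⁅⁆⁺ (unique y∈ x∈))) (≤-reflexive (∣⁅x⁆∣≡1 x))

1≤∣p∣ : x ∈ p → 1 ≤ ∣ p ∣
1≤∣p∣ x∈ = subst (1 ≤_) (sym (∣p∣≡1+∣p-x∣ x∈)) (s≤s z≤n)

2≤∣p∣ : x ∈ p → y ∈ p → x ≢ y → 2 ≤ ∣ p ∣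
2≤∣p∣ x∈ y∈ x≢y = subst (2 ≤_) (sym (∣p∣≡1+∣p-x∣ x∈)) (s≤s (1≤∣p∣ (x∈p-y⁺ y∈ (λ y≡x → x≢y (sym y≡x)))))

3≤∣p∣ : ∀ {z} → x ∈ p → y ∈ p → z ∈ p → x ≢ y → x ≢ z → y ≢ z → 3 ≤ ∣ p ∣
3≤∣p∣ x∈ y∈ z∈ x≢y x≢z y≢z =
  subst (3 ≤_) (sym (∣p∣≡1+∣p-x∣ x∈))
    (s≤s (2≤∣p∣ (x∈p-y⁺ y∈ (λ y≡x → x≢y (sym y≡x))) (x∈p-y⁺ z∈ (λ z≡x → x≢z (sym z≡x))) y≢z))

_⊆ₗ_ : List (Fin n) → Subset n → Set
ps ⊆ₗ p = ∀ {x} → x ∈ₗ ps → x ∈ p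

module _ {A : Set} where

  Unique-init : ∀ {xs : List A} {x} → Unique (xs ∷ʳ x) → Unique xs
  Unique-init {[]} _ = []
  Unique-init {_ ∷ xs} (y≢ ∷ unique) = ++⁻ˡ xs y≢ ∷ Unique-init unique

  Unique-last : ∀ {xs : List A} {x} → Unique (xs ∷ʳ x) → x ∉ₗ xs
  Unique-last {y ∷ ys} (y≢ ∷ _) (here refl) = All.lookup y≢ (∈-++⁺ʳ ys (here refl)) refl
  Unique-last (_ ∷ unique) (there x∈) = Unique-last unique x∈

removeAll : Subset n → List (Fin n) → Subset n
removeAll p [] = p
removeAll p (x ∷ xs) = removeAll (p - x) xs

removeAll⁻ : ∀ xs → x ∈ removeAll p xs → x ∈ p × x ∉ₗ xs
removeAll⁻ [] x∈ = x∈ , λ ()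
removeAll⁻ (y ∷ ys) x∈ with removeAll⁻ ys x∈
... | x∈p-y , x∉ys = p-x⊆p x∈p-y , λ { (here refl) → y∉p-y x∈p-y ; (there x∈ys) → x∉ys x∈ys }

removeAll⁺ : ∀ xs → x ∈ p → x ∉ₗ xs → x ∈ removeAll p xs
removeAll⁺ [] x∈ _ = x∈
removeAll⁺ (y ∷ ys) x∈ x∉ = removeAll⁺ ys (x∈p-y⁺ x∈ (λ x≡y → x∉ (here x≡y))) (λ x∈ys → x∉ (there x∈ys))

removeAll-∪ˡ : ∀ xs → (∀ {x} → x ∈ p → x ∉ₗ xs) → removeAll (p ∪ q) xs ≡ p ∪ removeAll q xs
removeAll-∪ˡ {p = p} {q} xs p#xs = ⊆-antisym to from
  where
  to : removeAll (p ∪ q) xs ⊆ p ∪ removeAll q xs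
  to x∈ with removeAll⁻ xs x∈
  ... | x∈p∪q , x∉xs = [ ∈∪ˡ , (λ x∈q → ∈∪ʳ (removeAll⁺ xs x∈q x∉xs)) ]′ (∈∪⁻ x∈p∪q)
  from : p ∪ removeAll q xs ⊆ removeAll (p ∪ q) xs
  from = ∪-least (λ x∈p → removeAll⁺ xs (∈∪ˡ x∈p) (p#xs x∈p))
                 (λ x∈ → removeAll⁺ xs (∈∪ʳ (proj₁ (removeAll⁻ xs x∈))) (proj₂ (removeAll⁻ xs x∈)))

∪⁅⁆-∪-swap : ∀ (p q : Subset n) x → (p ∪ ⁅ x ⁆) ∪ q ≡ p ∪ (q ∪ ⁅ x ⁆)
∪⁅⁆-∪-swap p q x = trans (∪-assoc p ⁅ x ⁆ q) (cong (p ∪_) (∪-comm ⁅ x ⁆ q))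

measure : Subset n → Subset n → ℕ
measure W A = ∣ W ∣ + ∣ W ─ A ∣

measure-delete : ∀ {W A : Subset n} {u} → u ∈ W → u ∉ A → measure (W - u) A < measure W A
measure-delete {W = W} {A} {u} u∈W u∉A = +-mono-<-≤ (x∈p⇒∣p-x∣<∣p∣ u∈W)
  (p⊆q⇒∣p∣≤∣q∣ {p = (W - u) ─ A} λ x∈ → x∈p∧x∉q⇒x∈p─q (p-x⊆p (p─q⊆p (W - u) A x∈)) (x∈p─q⇒x∉q {p = W - u} x∈))

measure-link : ∀ {W A : Subset n} {u} → u ∈ W → u ∉ A → measure W (A ∪ ⁅ u ⁆) < measure W A
measure-link {W = W} {A} {u} u∈W u∉A =
  +-monoʳ-< ∣ W ∣ (≤-trans (s≤s (p⊆q⇒∣p∣≤∣q∣ W─Au⊆)) (x∈p⇒∣p-x∣<∣p∣ (x∈p∧x∉q⇒x∈p─q u∈W u∉A)))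
  where
  W─Au⊆ : W ─ (A ∪ ⁅ u ⁆) ⊆ (W ─ A) - u
  W─Au⊆ x∈ = x∈p-y⁺ (x∈p∧x∉q⇒x∈p─q (p─q⊆p W _ x∈) (λ x∈A → x∈p─q⇒x∉q x∈ (∈∪ˡ x∈A)))
                    (λ x≡u → x∈p─q⇒x∉q x∈ (∈∪ʳ (∈⁅⁆⁺ x≡u)))

measure-remove : ∀ {W A : Subset n} {v} → v ∈ W → measure (W - v) (A - v) < measure W A
measure-remove {W = W} {A} {v} v∈W = +-mono-<-≤ (x∈p⇒∣p-x∣<∣p∣ v∈W) (p⊆q⇒∣p∣≤∣q∣ ⊆W─A)
  where
  ⊆W─A : (W - v) ─ (A - v) ⊆ W ─ A
  ⊆W─A x∈ with x∈p-y⁻ (p─q⊆p (W - v) _ x∈)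
  ... | x∈W , x≢v = x∈p∧x∉q⇒x∈p─q x∈W (λ x∈A → x∈p─q⇒x∉q x∈ (x∈p-y⁺ x∈A x≢v))

module _ {N : ℕ} where

  infix 4 _≅_
  _≅_ : Complex N → Complex N → Set
  X ≅ Y = ∀ σ → (X σ → Y σ) × (Y σ → X σ)

  ≅-refl : ∀ {X} → X ≅ X
  ≅-refl σ = (λ x → x) , (λ x → x)

  ≅-sym : ∀ {X Y} → X ≅ Y → Y ≅ X
  ≅-sym X≅Y σ = proj₂ (X≅Y σ) , proj₁ (X≅Y σ)

  ≅-trans : ∀ {X Y Z} → X ≅ Y → Y ≅ Z → X ≅ Z
  ≅-trans X≅Y Y≅Z σ = (λ x → proj₁ (Y≅Z σ) (proj₁ (X≅Y σ) x)) , (λ z → proj₂ (X≅Y σ) (proj₂ (Y≅Z σ) z))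

  Void-resp-≅ : ∀ {X Y} → X ≅ Y → Void X → Void Y
  Void-resp-≅ X≅Y void η y = void η (proj₂ (X≅Y η) y)

  FreeFace-resp-≅ : ∀ {X Y σ τ} → X ≅ Y → FreeFace X σ τ → FreeFace Y σ τ
  FreeFace-resp-≅ X≅Y (Xσ , Xτ , σ⊆τ , maximal) =
    proj₁ (X≅Y _) Xσ , proj₁ (X≅Y _) Xτ , σ⊆τ , λ η Yη → maximal η (proj₂ (X≅Y η) Yη)

  removeInterval-resp-≅ : ∀ {X Y σ τ} → X ≅ Y → removeInterval X σ τ ≅ removeInterval Y σ τ
  removeInterval-resp-≅ X≅Y η = (λ (x , out) → proj₁ (X≅Y η) x , out) , (λ (y , out) → proj₂ (X≅Y η) y , out)

  Collapsible-resp-≅ : ∀ {d X Y} → X ≅ Y → Collapsible d X → Collapsible d Y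
  Collapsible-resp-≅ X≅Y (done void) = done (Void-resp-≅ X≅Y void)
  Collapsible-resp-≅ X≅Y (collapse σ τ free |σ|≤d rest) =
    collapse σ τ (FreeFace-resp-≅ X≅Y free) |σ|≤d (Collapsible-resp-≅ (removeInterval-resp-≅ X≅Y) rest)

  deletion : Complex N → Fin N → Complex N
  deletion X v σ = X σ × v ∉ σ

  link : Complex N → Fin N → Complex N
  link X v σ = v ∉ σ × X (σ ∪ ⁅ v ⁆)

  link-face : ∀ {X v η} → v ∈ η → X η → link X v (η - v)
  link-face {X} v∈ Xη = y∉p-y , subst X (sym (p-x∪⁅x⁆≡p v∈)) Xη

  Void-deletion-link : ∀ {X} v → Void (deletion X v) → Void (link X v) → Void X
  Void-deletion-link {X} v void-del void-lk η Xη with v ∈? η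
  ... | yes v∈ = void-lk (η - v) (link-face {X} v∈ Xη)
  ... | no v∉ = void-del η (Xη , v∉)

  deletion≅ : ∀ {X v} → Void (link X v) → deletion X v ≅ X
  deletion≅ {X} void-lk η = proj₁ , λ Xη → Xη , λ v∈ → void-lk (η - _) (link-face {X} v∈ Xη)

  FreeFace-link : ∀ {X v σ τ} → FreeFace (link X v) σ τ → FreeFace X (σ ∪ ⁅ v ⁆) (τ ∪ ⁅ v ⁆)
  FreeFace-link {X} {v} {σ} {τ} ((v∉σ , Xσv) , (_ , Xτv) , σ⊆τ , maximal) =
    Xσv , Xτv , ∪⁅⁆-mono σ⊆τ , maximal′
    where
    maximal′ : ∀ η → X η → σ ∪ ⁅ v ⁆ ⊆ η → η ⊆ τ ∪ ⁅ v ⁆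
    maximal′ η Xη σv⊆η {y} y∈η with y ≟ v
    ... | yes y≡v = ∈∪ʳ (∈⁅⁆⁺ y≡v)
    ... | no y≢v = ∈∪ˡ (maximal (η - v) (link-face {X} (σv⊆η ∈∪⁅⁆) Xη) σ⊆η-v (x∈p-y⁺ y∈η y≢v))
      where
      σ⊆η-v : σ ⊆ η - v
      σ⊆η-v z∈σ = x∈p-y⁺ (σv⊆η (∈∪ˡ z∈σ)) λ { refl → v∉σ z∈σ }

  link-removeInterval : ∀ {X v σ τ} → v ∉ σ →
    removeInterval (link X v) σ τ ≅ link (removeInterval X (σ ∪ ⁅ v ⁆) (τ ∪ ⁅ v ⁆)) v
  link-removeInterval {X} {v} {σ} {τ} v∉σ η = to , from
    where
    to : removeInterval (link X v) σ τ η → link (removeInterval X (σ ∪ ⁅ v ⁆) (τ ∪ ⁅ v ⁆)) v η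
    to ((v∉η , Xηv) , out) = v∉η , Xηv , λ (σv⊆ηv , ηv⊆τv) →
      out ( (λ z∈σ → ∈∪⁅⁆⁻ (σv⊆ηv (∈∪ˡ z∈σ)) λ { refl → v∉σ z∈σ })
          , (λ z∈η → ∈∪⁅⁆⁻ (ηv⊆τv (∈∪ˡ z∈η)) λ { refl → v∉η z∈η }))
    from : link (removeInterval X (σ ∪ ⁅ v ⁆) (τ ∪ ⁅ v ⁆)) v η → removeInterval (link X v) σ τ η
    from (v∉η , Xηv , out) = (v∉η , Xηv) , λ (σ⊆η , η⊆τ) → out (∪⁅⁆-mono σ⊆η , ∪⁅⁆-mono η⊆τ)

  deletion-removeInterval : ∀ {X v σ τ} → v ∈ σ → deletion (removeInterval X σ τ) v ≅ deletion X v
  deletion-removeInterval v∈σ η = (λ ((Xη , _) , v∉η) → Xη , v∉η) ,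
                                  (λ (Xη , v∉η) → (Xη , λ (σ⊆η , _) → v∉η (σ⊆η v∈σ)) , v∉η)

  link-deletion-collapsible : ∀ {d d′ Y X v} → Collapsible d′ Y → Y ≅ link X v →
                              Collapsible d (deletion X v) → d′ < d → Collapsible d X
  link-deletion-collapsible (done void) Y≅lk col-del _ =
    Collapsible-resp-≅ (deletion≅ (Void-resp-≅ Y≅lk void)) col-del
  link-deletion-collapsible {X = X} {v} (collapse σ τ free |σ|≤d′ rest) Y≅lk col-del d′<d =
    collapse (σ ∪ ⁅ v ⁆) (τ ∪ ⁅ v ⁆) (FreeFace-link free-lk) |σv|≤d
      (link-deletion-collapsible rest
        (≅-trans (removeInterval-resp-≅ Y≅lk) (link-removeInterval {X} v∉σ))
        (Collapsible-resp-≅ (≅-sym (deletion-removeInterval ∈∪⁅⁆)) col-del) d′<d)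
    where
    free-lk : FreeFace (link X v) σ τ
    free-lk = FreeFace-resp-≅ Y≅lk free
    v∉σ : v ∉ σ
    v∉σ = proj₁ (proj₁ free-lk)
    |σv|≤d : ∣ σ ∪ ⁅ v ⁆ ∣ ≤ _
    |σv|≤d = ≤-trans (≤-reflexive (∣p∪⁅x⁆∣≡1+∣p∣ v∉σ)) (≤-trans (s≤s |σ|≤d′) d′<d)

  IsCone : Complex N → Fin N → Set
  IsCone X v = ∀ η → v ∉ η → (X η → X (η ∪ ⁅ v ⁆)) × (X (η ∪ ⁅ v ⁆) → X η)

  cone-deletion-face : ∀ {X v η} → IsCone X v → X η → deletion X v (η - v)
  cone-deletion-face {X} {v} {η} cone Xη with v ∈? η
  ... | yes v∈ = proj₂ (cone (η - v) y∉p-y) (subst X (sym (p-x∪⁅x⁆≡p v∈)) Xη) , y∉p-y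
  ... | no v∉ = subst X (sym (x∉p⇒p-x≡p v∉)) Xη , y∉p-y

  Void-cone : ∀ {X v} → IsCone X v → Void (deletion X v) → Void X
  Void-cone {X} cone void η Xη = void (η - _) (cone-deletion-face {X} cone Xη)

  FreeFace-cone : ∀ {X v σ τ} → IsCone X v → FreeFace (deletion X v) σ τ → FreeFace X σ (τ ∪ ⁅ v ⁆)
  FreeFace-cone {X} {v} {σ} {τ} cone ((Xσ , v∉σ) , (Xτ , v∉τ) , σ⊆τ , maximal) =
    Xσ , proj₁ (cone τ v∉τ) Xτ , (λ z∈σ → ∈∪ˡ (σ⊆τ z∈σ)) , maximal′
    where
    maximal′ : ∀ η → X η → σ ⊆ η → η ⊆ τ ∪ ⁅ v ⁆
    maximal′ η Xη σ⊆η {y} y∈η with y ≟ v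
    ... | yes y≡v = ∈∪ʳ (∈⁅⁆⁺ y≡v)
    ... | no y≢v = ∈∪ˡ (maximal (η - v) (cone-deletion-face {X} cone Xη) σ⊆η-v (x∈p-y⁺ y∈η y≢v))
      where
      σ⊆η-v : σ ⊆ η - v
      σ⊆η-v z∈σ = x∈p-y⁺ (σ⊆η z∈σ) λ { refl → v∉σ z∈σ }

  deletion-removeInterval-∪⁅⁆ : ∀ {X v σ τ} →
    removeInterval (deletion X v) σ τ ≅ deletion (removeInterval X σ (τ ∪ ⁅ v ⁆)) v
  deletion-removeInterval-∪⁅⁆ η =
    (λ ((Xη , v∉η) , out) → (Xη , λ (σ⊆η , η⊆τv) → out (σ⊆η , λ z∈η → ∈∪⁅⁆⁻ (η⊆τv z∈η) λ { refl → v∉η z∈η })) , v∉η) ,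
    (λ ((Xη , out) , v∉η) → (Xη , v∉η) , λ (σ⊆η , η⊆τ) → out (σ⊆η , λ z∈η → ∈∪ˡ (η⊆τ z∈η)))

  IsCone-removeInterval : ∀ {X v σ τ} → v ∉ σ → IsCone X v → IsCone (removeInterval X σ (τ ∪ ⁅ v ⁆)) v
  IsCone-removeInterval v∉σ cone η v∉η =
    (λ (Xη , out) → proj₁ (cone η v∉η) Xη , λ (σ⊆ηv , ηv⊆τv) →
       out ((λ z∈σ → ∈∪⁅⁆⁻ (σ⊆ηv z∈σ) λ { refl → v∉σ z∈σ }) , (λ z∈η → ηv⊆τv (∈∪ˡ z∈η)))) ,
    (λ (Xηv , out) → proj₂ (cone η v∉η) Xηv , λ (σ⊆η , η⊆τv) →
       out ((λ z∈σ → ∈∪ˡ (σ⊆η z∈σ)) , ∪-least η⊆τv ∈∪ʳ))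

  cone-collapsible : ∀ {d D X v} → Collapsible d D → D ≅ deletion X v → IsCone X v → Collapsible d X
  cone-collapsible {X = X} (done void) D≅del cone = done (Void-cone {X} cone (Void-resp-≅ D≅del void))
  cone-collapsible {X = X} {v} (collapse σ τ free |σ|≤d rest) D≅del cone =
    collapse σ (τ ∪ ⁅ v ⁆) (FreeFace-cone {X} cone free-del) |σ|≤d
      (cone-collapsible rest (≅-trans (removeInterval-resp-≅ D≅del) (deletion-removeInterval-∪⁅⁆ {X}))
        (IsCone-removeInterval {X} (proj₂ (proj₁ free-del)) cone))
    where
    free-del : FreeFace (deletion X v) σ τ
    free-del = FreeFace-resp-≅ D≅del free

  -- C(X) ≤ 2(n-1) - a without truncated subtraction, strengthened by: X is void when a > 2(n-1).
  -- The strengthening is what the d = 0 case of a link-deletion split needs.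
  record Bound (X : Complex N) (a n : ℕ) : Set₁ where
    field
      collapsible : ∀ d → n + n ≤ 2 + (d + a) → Collapsible d X
      void : n + n < 2 + a → Void X
  open Bound public

  Bound-resp-≅ : ∀ {X Y a n} → X ≅ Y → Bound X a n → Bound Y a n
  Bound-resp-≅ X≅Y bound = record
    { collapsible = λ d le → Collapsible-resp-≅ X≅Y (collapsible bound d le)
    ; void = λ lt → Void-resp-≅ X≅Y (void bound lt) }

  Void⇒Bound : ∀ {X a n} → Void X → Bound X a n
  Void⇒Bound empty = record { collapsible = λ _ _ → done empty ; void = λ _ → empty }

  Bound-link-deletion : ∀ {X a n} u → Bound (deletion X u) a n → Bound (link X u) (suc a) n → Bound X a n
  Bound-link-deletion {X} {a} {n} u bound-del bound-lk = record { collapsible = col ; void = empty }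
    where
    col : ∀ d → n + n ≤ 2 + (d + a) → Collapsible d X
    col zero le = Collapsible-resp-≅ (deletion≅ (void bound-lk (s≤s le))) (collapsible bound-del zero le)
    col (suc d) le = link-deletion-collapsible (collapsible bound-lk d (subst (λ k → n + n ≤ 2 + k) (sym (+-suc d a)) le))
                       ≅-refl (collapsible bound-del (suc d) le) ≤-refl
    empty : n + n < 2 + a → Void X
    empty lt = Void-deletion-link u (void bound-del lt) (void bound-lk (m<n⇒m<1+n lt))

  Bound-cone : ∀ {X a n} v → Bound (deletion X v) a n → IsCone X v → Bound X a n
  Bound-cone {X} v bound-del cone = record
    { collapsible = λ d le → cone-collapsible (collapsible bound-del d le) ≅-refl cone
    ; void = λ lt → Void-cone {X} cone (void bound-del lt) }

  Bound-peel : ∀ {X Y a a′ c m} → X ≅ Y → a ≡ a′ + c → c ≤ 2 → Bound Y a′ m → Bound X a (suc m)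
  Bound-peel {X} {Y} {a} {a′} {c} {m} X≅Y a≡a′+c c≤2 bound = record { collapsible = col ; void = empty }
    where
    lower : ∀ d → d + a ≤ 2 + (d + a′)
    lower d = begin
      d + a        ≡⟨ cong (d +_) a≡a′+c ⟩
      d + (a′ + c) ≤⟨ +-monoʳ-≤ d (+-monoʳ-≤ a′ c≤2) ⟩
      d + (a′ + 2) ≡⟨ sym (+-assoc d a′ 2) ⟩
      d + a′ + 2   ≡⟨ +-comm (d + a′) 2 ⟩
      2 + (d + a′) ∎
      where open ≤-Reasoning
    unfold : suc m + suc m ≡ 2 + (m + m)
    unfold = cong suc (+-suc m m)
    col : ∀ d → suc m + suc m ≤ 2 + (d + a) → Collapsible d X
    col d le = Collapsible-resp-≅ (≅-sym X≅Y)
                 (collapsible bound d (≤-trans (s≤s⁻¹ (s≤s⁻¹ (subst (_≤ 2 + (d + a)) unfold le))) (lower d)))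
    empty : suc m + suc m < 2 + a → Void X
    empty lt = Void-resp-≅ (≅-sym X≅Y) (void bound (≤-trans (s≤s⁻¹ (s≤s⁻¹ (subst (λ k → suc k ≤ 2 + a) unfold lt))) (lower 0)))

module _ {N : ℕ} (G : Graph N) where

  Adjacent : Fin N → Fin N → Set
  Adjacent u v = E G u v ≡ true

  adjacent-sym : ∀ {u v} → Adjacent u v → Adjacent v u
  adjacent-sym {u} {v} u~v = trans (E-sym G v u) u~v

  adjacent⇒≢ : ∀ {u v} → Adjacent u v → u ≢ v
  adjacent⇒≢ {u} u~u refl with trans (sym (irrefl G u)) u~u
  ... | ()

  ¬adjacent⇒E≡false : ∀ {u v} → ¬ Adjacent u v → E G u v ≡ false
  ¬adjacent⇒E≡false {u} {v} u≁v with E G u v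
  ... | true = ⊥-elim (u≁v refl)
  ... | false = refl

  Independent⇒¬adjacent : ∀ {S u v} → Independent G S → u ∈ S → v ∈ S → ¬ Adjacent u v
  Independent⇒¬adjacent {u = u} {v} indep u∈ v∈ u~v with trans (sym (indep u v u∈ v∈)) u~v
  ... | ()

  Independent-⊆ : ∀ {S S′} → S′ ⊆ S → Independent G S → Independent G S′
  Independent-⊆ S′⊆S indep u v u∈ v∈ = indep u v (S′⊆S u∈) (S′⊆S v∈)

  Independent-∪⁅⁆ : ∀ {S p} → Independent G S → (∀ {v} → v ∈ S → ¬ Adjacent p v) → Independent G (S ∪ ⁅ p ⁆)
  Independent-∪⁅⁆ {S} {p} indep p≁S u v u∈ v∈ with ∈∪⁻ u∈ | ∈∪⁻ v∈
  ... | inj₁ u∈S | inj₁ v∈S = indep u v u∈S v∈S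
  ... | inj₁ u∈S | inj₂ v∈p rewrite ∈⁅⁆⁻ v∈p = trans (E-sym G u p) (¬adjacent⇒E≡false (p≁S u∈S))
  ... | inj₂ u∈p | inj₁ v∈S rewrite ∈⁅⁆⁻ u∈p = ¬adjacent⇒E≡false (p≁S v∈S)
  ... | inj₂ u∈p | inj₂ v∈p rewrite ∈⁅⁆⁻ u∈p | ∈⁅⁆⁻ v∈p = irrefl G p

  infix 4 α[_]<_
  α[_]<_ : Subset N → ℕ → Set
  α[ U ]< n = IndepNumberLess G U n

  α<-⊆ : ∀ {U U′ n} → U′ ⊆ U → α[ U ]< n → α[ U′ ]< n
  α<-⊆ U′⊆U α<n S S⊆U′ indep = α<n S (λ x∈ → U′⊆U (S⊆U′ x∈)) indep

  α<⇒0< : ∀ {U n} → α[ U ]< n → 0 < n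
  α<⇒0< {n = n} α<n = subst (_< n) (∣⊥∣≡0 N) (α<n ⊥ (λ x∈ → ⊥-elim (∉⊥ x∈)) (λ _ _ x∈ → ⊥-elim (∉⊥ x∈)))

  α<-extend : ∀ {Y S p n} → α[ Y ]< n → S ⊆ Y → p ∈ Y → p ∉ S → Independent G S →
              (∀ {v} → v ∈ S → ¬ Adjacent p v) → ∣ S ∣ < n ∸ 1
  α<-extend {n = n} α<n S⊆Y p∈Y p∉S indep p≁S =
    ∸-monoˡ-≤ 1 (subst (_< n) (∣p∪⁅x⁆∣≡1+∣p∣ p∉S) (α<n _ (∪⁅⁆-⊆ S⊆Y p∈Y) (Independent-∪⁅⁆ indep p≁S)))

  α<-delete-isolated : ∀ {Y p n} → p ∈ Y → (∀ {w} → w ∈ Y → ¬ Adjacent p w) → α[ Y ]< n → α[ Y - p ]< n ∸ 1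
  α<-delete-isolated p∈Y p≁Y α<n S S⊆ indep =
    α<-extend α<n (λ x∈ → p-x⊆p (S⊆ x∈)) p∈Y (λ p∈S → y∉p-y (S⊆ p∈S)) indep
      (λ v∈S → p≁Y (p-x⊆p (S⊆ v∈S)))

  α<-delete-leaf : ∀ {Y p q n} → p ∈ Y → (∀ {w} → w ∈ Y → Adjacent p w → w ≡ q) →
                   α[ Y ]< n → α[ Y - p - q ]< n ∸ 1
  α<-delete-leaf p∈Y only-q α<n S S⊆ indep =
    α<-extend α<n S⊆Y p∈Y (λ p∈S → y∉p-y (p-x⊆p (S⊆ p∈S))) indep
      (λ v∈S p~v → proj₂ (x∈p-y⁻ (S⊆ v∈S)) (only-q (S⊆Y v∈S) p~v))
    where
    S⊆Y : _ ⊆ _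
    S⊆Y x∈ = p-x⊆p (p-x⊆p (S⊆ x∈))

  α<-restore-vertex : ∀ {Y p m} → α[ Y - p ]< m → α[ Y ]< suc m
  α<-restore-vertex {p = p} α<m S S⊆Y indep =
    ≤-trans (s≤s (∣p∣≤1+∣p-x∣ p S)) (s≤s (α<m (S - p) (p⊆q⇒p-x⊆q-x S⊆Y) (Independent-⊆ p-x⊆p indep)))

  ∣S∣≤1+∣S-p-q∣ : ∀ {S p q} → Independent G S → Adjacent p q → ∣ S ∣ ≤ suc ∣ S - p - q ∣
  ∣S∣≤1+∣S-p-q∣ {S} {p} {q} indep p~q with p ∈? S
  ... | no p∉S = ≤-trans (p⊆q⇒∣p∣≤∣q∣ (p⊆q∧x∉p⇒p⊆q-x (λ y∈ → y∈) p∉S)) (∣p∣≤1+∣p-x∣ q (S - p))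
  ... | yes p∈S = ≤-reflexive (trans (∣p∣≡1+∣p-x∣ p∈S) (cong (λ T → suc ∣ T ∣) (sym (x∉p⇒p-x≡p q∉S-p))))
    where
    q∉S-p : q ∉ S - p
    q∉S-p q∈ = Independent⇒¬adjacent indep p∈S (p-x⊆p q∈) p~q

  α<-restore-edge : ∀ {Y p q m} → Adjacent p q → α[ Y - p - q ]< m → α[ Y ]< suc m
  α<-restore-edge p~q α<m S S⊆Y indep =
    ≤-trans (s≤s (∣S∣≤1+∣S-p-q∣ indep p~q))
      (s≤s (α<m _ (p⊆q⇒p-x⊆q-x (p⊆q⇒p-x⊆q-x S⊆Y)) (Independent-⊆ (λ x∈ → p-x⊆p (p-x⊆p x∈)) indep)))

  Peelable : Subset N → List (Fin N) → Set
  Peelable Y [] = Unit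
  Peelable Y (p ∷ []) = p ∈ Y × (∀ {w} → w ∈ Y → ¬ Adjacent p w)
  Peelable Y (p ∷ q ∷ ps) = p ∈ Y × Adjacent p q × (∀ {w} → w ∈ Y → Adjacent p w → w ≡ q) × Peelable (Y - p - q) ps

  α<-peel : ∀ {Y n} ps → Peelable Y ps → α[ Y ]< n → α[ removeAll Y ps ]< n ∸ ⌈ length ps /2⌉
  α<-peel [] _ α<n = α<n
  α<-peel (p ∷ []) (p∈Y , p≁Y) α<n = α<-delete-isolated p∈Y p≁Y α<n
  α<-peel {Y} {n} (p ∷ q ∷ ps) (p∈Y , _ , only-q , peelable) α<n =
    subst (α[ removeAll (Y - p - q) ps ]<_) (∸-+-assoc n 1 _) (α<-peel ps peelable (α<-delete-leaf p∈Y only-q α<n))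

  α<-unpeel : ∀ {Y m} ps → Peelable Y ps → α[ removeAll Y ps ]< m → α[ Y ]< m + ⌈ length ps /2⌉
  α<-unpeel {Y} {m} [] _ α<m = subst (α[ Y ]<_) (sym (+-identityʳ m)) α<m
  α<-unpeel {Y} {m} (p ∷ []) _ α<m = subst (α[ Y ]<_) (+-comm 1 m) (α<-restore-vertex α<m)
  α<-unpeel {Y} {m} (p ∷ q ∷ ps) (_ , p~q , _ , peelable) α<m =
    subst (α[ Y ]<_) (sym (+-suc m _)) (α<-restore-edge p~q (α<-unpeel ps peelable α<m))

  -- An independent set through x avoids q, and (X ∪ {x}) ∖ {q} peels along x ∷ ps
  -- with the same count as X along ps ∷ʳ q.
  α<-cone : ∀ {X n} x ps q → Adjacent x q → Peelable X (ps ∷ʳ q) → Peelable ((X ∪ ⁅ x ⁆) - q) (x ∷ ps) →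
            removeAll ((X ∪ ⁅ x ⁆) - q) (x ∷ ps) ⊆ removeAll X (ps ∷ʳ q) →
            α[ X ]< n → α[ X ∪ ⁅ x ⁆ ]< n
  α<-cone {X} {n} x ps q x~q peel peel′ rest′⊆rest α<n S S⊆ indep with x ∈? S
  ... | no x∉S = α<n S (λ y∈ → ∈∪⁅⁆⁻ (S⊆ y∈) λ { refl → x∉S y∈ }) indep
  ... | yes x∈S = subst (∣ S ∣ <_) n∸h+h≡n (α<′ S S⊆X∪x-q indep)
    where
    α<rest : α[ removeAll X (ps ∷ʳ q) ]< n ∸ ⌈ length (ps ∷ʳ q) /2⌉
    α<rest = α<-peel (ps ∷ʳ q) peel α<n
    α<′ : α[ (X ∪ ⁅ x ⁆) - q ]< (n ∸ ⌈ length (ps ∷ʳ q) /2⌉) + ⌈ length (x ∷ ps) /2⌉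
    α<′ = α<-unpeel (x ∷ ps) peel′ (α<-⊆ rest′⊆rest α<rest)
    same-length : length (x ∷ ps) ≡ length (ps ∷ʳ q)
    same-length = sym (trans (length-++ ps) (+-comm (length ps) 1))
    n∸h+h≡n : (n ∸ ⌈ length (ps ∷ʳ q) /2⌉) + ⌈ length (x ∷ ps) /2⌉ ≡ n
    n∸h+h≡n = trans (cong (λ l → (n ∸ ⌈ length (ps ∷ʳ q) /2⌉) + ⌈ l /2⌉) same-length)
                    (m∸n+n≡m {n} {⌈ length (ps ∷ʳ q) /2⌉} (<⇒≤ (m∸n≢0⇒n<m λ n∸h≡0 → <-irrefl (sym n∸h≡0) (α<⇒0< α<rest))))
    S⊆X∪x-q : S ⊆ (X ∪ ⁅ x ⁆) - q
    S⊆X∪x-q y∈ = x∈p-y⁺ (S⊆ y∈) λ { refl → Independent⇒¬adjacent indep x∈S y∈ x~q }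

  Lk : Subset N → Subset N → ℕ → Complex N
  Lk W A n σ = σ ⊆ W ∖ A × α[ σ ∪ A ]< n

  Lk-downward : ∀ {W A n σ σ′} → σ′ ⊆ σ → Lk W A n σ → Lk W A n σ′
  Lk-downward σ′⊆σ (σ⊆ , α<n) = (λ x∈ → σ⊆ (σ′⊆σ x∈)) , α<-⊆ (∪-least (λ x∈ → ∈∪ˡ (σ′⊆σ x∈)) ∈∪ʳ) α<n

  deletion-Lk : ∀ {W A n} u → deletion (Lk W A n) u ≅ Lk (W - u) A n
  deletion-Lk u σ =
    (λ ((σ⊆ , α<n) , u∉σ) → (λ x∈ → x∈p-y⁺ (proj₁ (σ⊆ x∈)) (λ { refl → u∉σ x∈ }) , proj₂ (σ⊆ x∈)) , α<n) ,
    (λ (σ⊆ , α<n) → ((λ x∈ → p-x⊆p (proj₁ (σ⊆ x∈)) , proj₂ (σ⊆ x∈)) , α<n) , (λ u∈σ → y∉p-y (proj₁ (σ⊆ u∈σ))))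

  link-Lk : ∀ {W A n u} → u ∈ W → u ∉ A → link (Lk W A n) u ≅ Lk W (A ∪ ⁅ u ⁆) n
  link-Lk {W} {A} {n} {u} u∈W u∉A σ = to , from
    where
    to : link (Lk W A n) u σ → Lk W (A ∪ ⁅ u ⁆) n σ
    to (u∉σ , σu⊆ , α<n) =
      (λ x∈ → proj₁ (σu⊆ (∈∪ˡ x∈)) , λ x∈Au → proj₂ (σu⊆ (∈∪ˡ x∈)) (∈∪⁅⁆⁻ x∈Au λ { refl → u∉σ x∈ })) ,
      subst (α[_]< n) (∪⁅⁆-∪-swap σ A u) α<n
    from : Lk W (A ∪ ⁅ u ⁆) n σ → link (Lk W A n) u σ
    from (σ⊆ , α<n) =
      (λ u∈σ → proj₂ (σ⊆ u∈σ) ∈∪⁅⁆) ,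
      ∪⁅⁆-⊆∖ (λ x∈σ → proj₁ (σ⊆ x∈σ) , λ x∈A → proj₂ (σ⊆ x∈σ) (∈∪ˡ x∈A)) u∈W u∉A ,
      subst (α[_]< n) (sym (∪⁅⁆-∪-swap σ A u)) α<n

  Lk-peel : ∀ {W A} m ps → ps ⊆ₗ A → (∀ {σ} → σ ⊆ W ∖ A → Peelable (σ ∪ A) ps) →
            Lk W A (m + ⌈ length ps /2⌉) ≅ Lk (removeAll W ps) (removeAll A ps) m
  Lk-peel {W} {A} m ps ps⊆A peelable σ = to , from
    where
    σ#ps : σ ⊆ W ∖ A → ∀ {x} → x ∈ σ → x ∉ₗ ps
    σ#ps σ⊆ x∈ x∈ps = proj₂ (σ⊆ x∈) (ps⊆A x∈ps)
    to : Lk W A (m + ⌈ length ps /2⌉) σ → Lk (removeAll W ps) (removeAll A ps) m σ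
    to (σ⊆ , α<n) =
      (λ x∈ → removeAll⁺ ps (proj₁ (σ⊆ x∈)) (σ#ps σ⊆ x∈) , λ x∈A′ → proj₂ (σ⊆ x∈) (proj₁ (removeAll⁻ ps x∈A′))) ,
      subst₂ α[_]<_ (removeAll-∪ˡ ps (σ#ps σ⊆)) (m+n∸n≡m m ⌈ length ps /2⌉) (α<-peel ps (peelable σ⊆) α<n)
    from : Lk (removeAll W ps) (removeAll A ps) m σ → Lk W A (m + ⌈ length ps /2⌉) σ
    from (σ⊆′ , α<m) = σ⊆ , α<-unpeel ps (peelable σ⊆) (subst (α[_]< m) (sym (removeAll-∪ˡ ps (σ#ps σ⊆))) α<m)
      where
      σ⊆ : σ ⊆ W ∖ A
      σ⊆ x∈ with removeAll⁻ ps (proj₁ (σ⊆′ x∈))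
      ... | x∈W , x∉ps = x∈W , λ x∈A → proj₂ (σ⊆′ x∈) (removeAll⁺ ps x∈A x∉ps)

  nbhdIn : Subset N → Fin N → Subset N
  nbhdIn W v = nbhd G v ∩ W

  degIn : Subset N → Fin N → ℕ
  degIn W v = ∣ nbhdIn W v ∣

  ∈nbhdIn⁺ : ∀ {W v u} → Adjacent v u → u ∈ W → u ∈ nbhdIn W v
  ∈nbhdIn⁺ {v = v} {u} v~u u∈W = x∈p∩q⁺ (lookup⇒[]= u (nbhd G v) (trans (lookup∘tabulate (E G v) u) v~u) , u∈W)

  ∈nbhdIn⁻ : ∀ {W v u} → u ∈ nbhdIn W v → Adjacent v u × u ∈ W
  ∈nbhdIn⁻ {W} {v} {u} u∈ with x∈p∩q⁻ (nbhd G v) W u∈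
  ... | u∈nbhd , u∈W = trans (sym (lookup∘tabulate (E G v) u)) ([]=⇒lookup u∈nbhd) , u∈W

  degIn-mono : ∀ {W W′} v → W′ ⊆ W → degIn W′ v ≤ degIn W v
  degIn-mono v W′⊆W = p⊆q⇒∣p∣≤∣q∣ λ u∈ → ∈nbhdIn⁺ (proj₁ (∈nbhdIn⁻ u∈)) (W′⊆W (proj₂ (∈nbhdIn⁻ u∈)))

  degIn-delete : ∀ {W v u} → Adjacent v u → u ∈ W → suc (degIn (W - u) v) ≤ degIn W v
  degIn-delete {W} {v} {u} v~u u∈W =
    ≤-reflexive (sym (trans (∣p∣≡1+∣p-x∣ (∈nbhdIn⁺ {W} v~u u∈W)) (cong (λ s → suc ∣ s ∣) (⊆-antisym to from))))
    where
    to : nbhdIn W v - u ⊆ nbhdIn (W - u) v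
    to w∈ with x∈p-y⁻ w∈
    ... | w∈nbhd , w≢u = ∈nbhdIn⁺ (proj₁ (∈nbhdIn⁻ w∈nbhd)) (x∈p-y⁺ (proj₂ (∈nbhdIn⁻ w∈nbhd)) w≢u)
    from : nbhdIn (W - u) v ⊆ nbhdIn W v - u
    from w∈ with ∈nbhdIn⁻ w∈
    ... | v~w , w∈W-u = x∈p-y⁺ (∈nbhdIn⁺ v~w (p-x⊆p w∈W-u)) (proj₂ (x∈p-y⁻ w∈W-u))

  degIn≤1 : ∀ {W v q} → (∀ {w} → w ∈ W → Adjacent v w → w ≡ q) → degIn W v ≤ 1
  degIn≤1 only-q = ∣p∣≤1 λ x∈ y∈ → trans (only-q (proj₂ (∈nbhdIn⁻ x∈)) (proj₁ (∈nbhdIn⁻ x∈)))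
                                          (sym (only-q (proj₂ (∈nbhdIn⁻ y∈)) (proj₁ (∈nbhdIn⁻ y∈))))

  degIn≤1⇒unique : ∀ {W v a b} → degIn W v ≤ 1 → Adjacent v a → a ∈ W → Adjacent v b → b ∈ W → a ≡ b
  degIn≤1⇒unique {W} {a = a} {b} deg≤1 v~a a∈W v~b b∈W with a ≟ b
  ... | yes a≡b = a≡b
  ... | no a≢b = ⊥-elim (1+n≰n (≤-trans (2≤∣p∣ (∈nbhdIn⁺ {W} v~a a∈W) (∈nbhdIn⁺ v~b b∈W) a≢b) deg≤1))

  other-neighbour : ∀ {W v a} → 2 ≤ degIn W v → Adjacent v a → a ∈ W → ∃[ b ] Adjacent v b × b ∈ W × b ≢ a
  other-neighbour {W} {v} {a} 2≤deg v~a a∈W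
    with 0<∣p∣⇒Nonempty {p = nbhdIn W v - a} (≤-pred (subst (2 ≤_) (∣p∣≡1+∣p-x∣ (∈nbhdIn⁺ {W} v~a a∈W)) 2≤deg))
  ... | b , b∈ = b , proj₁ (∈nbhdIn⁻ (p-x⊆p b∈)) , proj₂ (∈nbhdIn⁻ (p-x⊆p b∈)) , proj₂ (x∈p-y⁻ b∈)

  two-neighbours : ∀ {W v} → 2 ≤ degIn W v → ∃[ a ] ∃[ b ] Adjacent v a × a ∈ W × Adjacent v b × b ∈ W × a ≢ b
  two-neighbours {W} {v} 2≤deg with 0<∣p∣⇒Nonempty {p = nbhdIn W v} (≤-trans (s≤s z≤n) 2≤deg)
  ... | a , a∈ with other-neighbour 2≤deg (proj₁ (∈nbhdIn⁻ a∈)) (proj₂ (∈nbhdIn⁻ a∈))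
  ... | b , v~b , b∈W , b≢a = a , b , proj₁ (∈nbhdIn⁻ a∈) , proj₂ (∈nbhdIn⁻ a∈) , v~b , b∈W , λ a≡b → b≢a (sym a≡b)

  data Walk (W : Subset N) (a : Fin N) : Fin N → Set where
    stop : Walk W a a
    step : ∀ {u w} → Walk W a u → Adjacent u w → w ∈ W → Walk W a w

  walk-delete : ∀ {W a w} u → a ∈ W - u → Walk W a w →
                (Walk (W - u) a w × w ∈ W - u) ⊎ (∃[ z ] Walk (W - u) a z × z ∈ W - u × Adjacent z u)
  walk-delete u a∈ stop = inj₁ (stop , a∈)
  walk-delete {w = w} u a∈ (step {u = v} walk v~w w∈W) with walk-delete u a∈ walk
  ... | inj₂ stuck = inj₂ stuck
  ... | inj₁ (walk′ , v∈) with w ≟ u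
  ...   | yes refl = inj₂ (v , walk′ , v∈ , v~w)
  ...   | no w≢u = inj₁ (step walk′ v~w (x∈p-y⁺ w∈W w≢u) , x∈p-y⁺ w∈W w≢u)

  next : List (Fin N) → Fin N → Fin N
  next [] r = r
  next (q ∷ _) r = q

  next-∈ : ∀ ps r → next ps r ∈ₗ ps ⊎ next ps r ≡ r
  next-∈ [] r = inj₂ refl
  next-∈ (q ∷ _) r = inj₁ (here refl)

  Segment : Subset N → Fin N → List (Fin N) → Fin N → Set
  Segment W l [] r = Unit
  Segment W l (p ∷ ps) r = p ∈ W × Adjacent p l × Adjacent p (next ps r) ×
                           (∀ {w} → w ∈ W → Adjacent p w → w ≡ l ⊎ w ≡ next ps r) × Segment W p ps r

  segment⇒peelable : ∀ {W Y l r} ps → Segment W l ps r → Unique ps → ps ⊆ₗ Y → Y ⊆ W → l ∉ Y → r ∉ Y →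
                     Peelable Y ps
  segment⇒peelable [] _ _ _ _ _ _ = tt
  segment⇒peelable (p ∷ []) (_ , _ , _ , only-lr , _) _ ps⊆Y Y⊆W l∉Y r∉Y =
    ps⊆Y (here refl) , λ w∈Y p~w → [ (λ { refl → l∉Y w∈Y }) , (λ { refl → r∉Y w∈Y }) ]′ (only-lr (Y⊆W w∈Y) p~w)
  segment⇒peelable {Y = Y} (p ∷ q ∷ ps) (_ , _ , p~q , only-lq , (_ , _ , _ , _ , segment)) (p≢ ∷ q≢ ∷ unique)
                   ps⊆Y Y⊆W l∉Y r∉Y =
    ps⊆Y (here refl) , p~q ,
    (λ w∈Y p~w → [ (λ { refl → ⊥-elim (l∉Y w∈Y) }) , (λ w≡q → w≡q) ]′ (only-lq (Y⊆W w∈Y) p~w)) ,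
    segment⇒peelable ps segment unique rest⊆ (λ x∈ → Y⊆W (p-x⊆p (p-x⊆p x∈))) y∉p-y (λ r∈ → r∉Y (p-x⊆p (p-x⊆p r∈)))
    where
    rest⊆ : ps ⊆ₗ (Y - p - q)
    rest⊆ x∈ = x∈p-y⁺ (x∈p-y⁺ (ps⊆Y (there (there x∈))) λ { refl → All.lookup p≢ (there x∈) refl })
                      λ { refl → All.lookup q≢ x∈ refl }

  segment-init : ∀ {W l r} ps q → Segment W l (ps ∷ʳ q) r → Segment W l ps q
  segment-init [] q _ = tt
  segment-init (p ∷ []) q (p∈W , p~l , p~q , only , _) = p∈W , p~l , p~q , only , tt
  segment-init (p ∷ p′ ∷ ps) q (p∈W , p~l , p~p′ , only , segment) = p∈W , p~l , p~p′ , only , segment-init (p′ ∷ ps) q segment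

  segment-last : ∀ {W l r} ps q → Segment W l (ps ∷ʳ q) r → Adjacent q r
  segment-last [] q (_ , _ , q~r , _) = q~r
  segment-last (p ∷ ps) q (_ , _ , _ , _ , segment) = segment-last ps q segment

  segment-walk : ∀ {W W′ l r} p ps → Segment W l (p ∷ ps) r → (p ∷ ps) ⊆ₗ W′ → ∀ {x} → x ∈ₗ p ∷ ps → Walk W′ x p
  segment-walk p ps _ _ (here refl) = stop
  segment-walk p (q ∷ ps) (_ , _ , _ , _ , segment) ⊆W′ (there x∈) =
    step (segment-walk q ps segment (λ y∈ → ⊆W′ (there y∈)) x∈) (proj₁ (proj₂ segment)) (⊆W′ (here refl))

  segment-inner : ∀ {W l r} p ps → Segment W l (p ∷ ps) r → ∀ {x w} → x ∈ₗ p ∷ ps → x ≢ p →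
                  w ∈ W → Adjacent x w → w ∈ₗ p ∷ ps ⊎ w ≡ r
  segment-inner p ps _ (here x≡p) x≢p = ⊥-elim (x≢p x≡p)
  segment-inner {r = r} p (q ∷ ps) (_ , _ , _ , _ , segment) {x} (there x∈) _ w∈W x~w with x ≟ q
  ... | yes refl = [ (λ w≡p → inj₁ (here w≡p)) , (λ { refl → [ (λ n∈ → inj₁ (there (there n∈))) , inj₂ ]′ (next-∈ ps r) }) ]′
                     (proj₁ (proj₂ (proj₂ (proj₂ segment))) w∈W x~w)
  ... | no x≢q = [ (λ w∈ → inj₁ (there w∈)) , inj₂ ]′ (segment-inner q ps segment x∈ x≢q w∈W x~w)

  Lk-void : ∀ {W A} → Void (Lk W A 0)
  Lk-void σ (_ , α<0) with α<⇒0< α<0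
  ... | ()

  Lk-link-deletion : ∀ {W A n u} → u ∈ W → u ∉ A → Bound (Lk (W - u) A n) ∣ A ∣ n →
                     Bound (Lk W (A ∪ ⁅ u ⁆) n) ∣ A ∪ ⁅ u ⁆ ∣ n → Bound (Lk W A n) ∣ A ∣ n
  Lk-link-deletion {W} {A} {n} {u} u∈W u∉A bound-del bound-lk =
    Bound-link-deletion u (Bound-resp-≅ (≅-sym (deletion-Lk u)) bound-del)
      (Bound-resp-≅ (≅-sym (link-Lk u∈W u∉A)) (subst (λ a → Bound (Lk W (A ∪ ⁅ u ⁆) n) a n) (∣p∪⁅x⁆∣≡1+∣p∣ u∉A) bound-lk))

  ReachesEnd : Subset N → Fin N → Set
  ReachesEnd W a = ∃[ w ] Walk W a w × w ∈ W × degIn W w ≤ 1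

  InPathComponents : Subset N → Subset N → Set
  InPathComponents W A = ∀ {a} → a ∈ A → ReachesEnd W a

  InPathComponents-∪⁅⁆ : ∀ {W A u} → InPathComponents W A → ReachesEnd W u → InPathComponents W (A ∪ ⁅ u ⁆)
  InPathComponents-∪⁅⁆ {W} inPaths u-end a∈ = [ inPaths , (λ a∈u → subst (ReachesEnd W) (sym (∈⁅⁆⁻ a∈u)) u-end) ]′ (∈∪⁻ a∈)

  segment⇒InPathComponents : ∀ {W A l r} p ps → Segment W l (p ∷ ps) r → l ∉ₗ p ∷ ps →
                             (∀ {x} → x ∈ A → x ∈ₗ p ∷ ps) → (p ∷ ps) ⊆ₗ W → InPathComponents (W - l) A
  segment⇒InPathComponents {W} {l = l} {r} p ps segment@(_ , _ , _ , only , _) l∉ A⊆ps ps⊆W a∈ =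
    p , segment-walk p ps segment ps⊆W-l (A⊆ps a∈) , ps⊆W-l (here refl) ,
    degIn≤1 {q = next ps r} (λ w∈ p~w → [ (λ { refl → ⊥-elim (y∉p-y w∈) }) , (λ w≡next → w≡next) ]′ (only (p-x⊆p w∈) p~w))
    where
    ps⊆W-l : (p ∷ ps) ⊆ₗ (W - l)
    ps⊆W-l x∈ = x∈p-y⁺ (ps⊆W x∈) λ { refl → l∉ x∈ }

  segment-not-loop : ∀ {W l p} → 2 ≤ degIn W p → ¬ Segment W l (p ∷ []) l
  segment-not-loop 2≤deg (_ , _ , _ , only , _) with two-neighbours 2≤deg
  ... | a , b , p~a , a∈W , p~b , b∈W , a≢b = a≢b (trans (≡l (only a∈W p~a)) (sym (≡l (only b∈W p~b))))
    where
    ≡l : ∀ {w l} → w ≡ l ⊎ w ≡ l → w ≡ l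
    ≡l = [ (λ e → e) , (λ e → e) ]′

  end? : ∀ W → Dec (∃[ w ] w ∈ W × degIn W w ≤ 1)
  end? W = any? λ w → (w ∈? W) ×-dec (degIn W w ≤? 1)

  neighbour? : ∀ W v → Dec (∃[ u ] u ∈ W × Adjacent v u)
  neighbour? W v = any? λ u → (u ∈? W) ×-dec (E G v u Bool.≟ true)

  bound-empty : ∀ {W A n} → Empty W → A ⊆ W → Bound (Lk W A (suc n)) ∣ A ∣ (suc n)
  bound-empty {W} {A} {n} empty A⊆W = record
    { collapsible = λ d _ → collapse ⊥ ⊥ (face⊥ , face⊥ , (λ x∈ → x∈) , λ η Lkη _ → only⊥ Lkη)
                              (subst (_≤ d) (sym (∣⊥∣≡0 N)) z≤n)
                              (done λ η (Lkη , out) → out ((λ x∈ → ⊥-elim (∉⊥ x∈)) , only⊥ Lkη))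
    ; void = λ lt → ⊥-elim (<⇒≱ (subst (λ a → suc n + suc n < 2 + a) (Empty⇒∣p∣≡0 A-empty) lt)
                         (+-mono-≤ (s≤s (z≤n {n})) (s≤s (z≤n {n})))) }
    where
    A-empty : Empty A
    A-empty (a , a∈A) = empty (a , A⊆W a∈A)
    only⊥ : ∀ {η} → Lk W A (suc n) η → η ⊆ ⊥
    only⊥ (η⊆ , _) x∈ = ⊥-elim (empty (_ , proj₁ (η⊆ x∈)))
    face⊥ : Lk W A (suc n) ⊥
    face⊥ = (λ x∈ → ⊥-elim (∉⊥ x∈)) ,
            λ S S⊆ _ → subst (_< suc n) (sym (Empty⇒∣p∣≡0 λ (x , x∈S) → A-empty (x , ∈∪⁻-⊥ (S⊆ x∈S)))) (s≤s z≤n)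
      where
      ∈∪⁻-⊥ : ∀ {x} → x ∈ ⊥ ∪ A → x ∈ A
      ∈∪⁻-⊥ x∈ = [ (λ x∈⊥ → ⊥-elim (∉⊥ x∈⊥)) , (λ x∈A → x∈A) ]′ (∈∪⁻ x∈)

  Lk-⊤≅lk : ∀ {A n} → Lk ⊤ A n ≅ lk (I G n) A
  Lk-⊤≅lk {A} σ =
    (λ (σ⊆ , α<n) → Empty-unique (λ (x , x∈) → proj₂ (σ⊆ (proj₁ (x∈p∩q⁻ σ A x∈))) (proj₂ (x∈p∩q⁻ σ A x∈))) , α<n) ,
    (λ (σ∩A≡⊥ , α<n) → (λ {x} x∈ → ∈⊤ , λ x∈A → ∉⊥ (subst (x ∈_) σ∩A≡⊥ (x∈p∩q⁺ (x∈ , x∈A)))) , α<n)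

  Reach⇒Walk : ∀ {a w} → Reach G a w → Walk ⊤ a w
  Reach⇒Walk here = stop
  Reach⇒Walk (step reach a~w) = step (Reach⇒Walk reach) a~w ∈⊤

  pathComponent⇒ReachesEnd : ∀ {a} → ComponentIsPath G a → ReachesEnd ⊤ a
  pathComponent⇒ReachesEnd {a} (_ , f , _ , reaches , adjacent⇔) =
    f zero , Reach⇒Walk a⇝f0 , ∈⊤ , ∣p∣≤1 λ x∈ y∈ → unique-index1 (index1 x∈) (index1 y∈)
    where
    a⇝f0 : Reach G a (f zero)
    a⇝f0 = Equivalence.from (reaches (f zero)) (zero , refl)
    index1 : ∀ {x} → x ∈ nbhdIn ⊤ (f zero) → ∃[ i ] f i ≡ x × toℕ i ≡ 1
    index1 {x} x∈ with ∈nbhdIn⁻ x∈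
    ... | f0~x , _ with Equivalence.to (reaches x) (step a⇝f0 f0~x)
    ...   | i , refl with Equivalence.to (adjacent⇔ zero i) f0~x
    ...     | inj₂ i≡1 = i , refl , i≡1
    unique-index1 : ∀ {x y} → ∃[ i ] f i ≡ x × toℕ i ≡ 1 → ∃[ j ] f j ≡ y × toℕ j ≡ 1 → x ≡ y
    unique-index1 (i , refl , i≡1) (j , refl , j≡1) = cong f (toℕ-injective (trans i≡1 (sym j≡1)))

  module _ (deg≤2 : MaxDegreeAtMost2 G) where

    degIn≤2 : ∀ W v → degIn W v ≤ 2
    degIn≤2 W v = ≤-trans (∣p∩q∣≤∣p∣ (nbhd G v) W) (deg≤2 v)

    third-neighbour : ∀ {W v a b c} → Adjacent v a → a ∈ W → Adjacent v b → b ∈ W → a ≢ b →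
                      Adjacent v c → c ∈ W → c ≡ a ⊎ c ≡ b
    third-neighbour {W} {v} {a} {b} {c} v~a a∈W v~b b∈W a≢b v~c c∈W with c ≟ a | c ≟ b
    ... | yes c≡a | _ = inj₁ c≡a
    ... | no _ | yes c≡b = inj₂ c≡b
    ... | no c≢a | no c≢b =
      ⊥-elim (1+n≰n (≤-trans (3≤∣p∣ (∈nbhdIn⁺ {W} v~a a∈W) (∈nbhdIn⁺ v~b b∈W) (∈nbhdIn⁺ v~c c∈W)
                                    a≢b (λ a≡c → c≢a (sym a≡c)) (λ b≡c → c≢b (sym b≡c)))
                             (degIn≤2 W v)))

    InPathComponents-delete : ∀ {W A A′} u → u ∈ W → InPathComponents W A → A′ ⊆ A → A′ ⊆ W - u →
                              InPathComponents (W - u) A′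
    InPathComponents-delete {W} u u∈W inPaths A′⊆A A′⊆W-u a∈ with inPaths (A′⊆A a∈)
    ... | w , walk , w∈W , deg≤1 with walk-delete u (A′⊆W-u a∈) walk
    ...   | inj₁ (walk′ , w∈) = w , walk′ , w∈ , ≤-trans (degIn-mono w p-x⊆p) deg≤1
    ...   | inj₂ (z , walk′ , z∈ , z~u) = z , walk′ , z∈ , s≤s⁻¹ (≤-trans (degIn-delete z~u u∈W) (degIn≤2 W z))

    segment-extend : ∀ {W l r} p ps → (∀ {w} → w ∈ W → 2 ≤ degIn W w) → Segment W l (p ∷ ps) r → l ∈ W →
                     l ∉ₗ p ∷ ps → l ≢ r → ∃[ l′ ] l′ ∈ W × l′ ∉ₗ l ∷ p ∷ ps × Segment W l′ (l ∷ p ∷ ps) r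
    segment-extend p ps deg≥2 segment@(p∈W , p~l , _) l∈W l∉ l≢r
      with other-neighbour (deg≥2 l∈W) (adjacent-sym p~l) p∈W
    ... | l′ , l~l′ , l′∈W , l′≢p =
      l′ , l′∈W , l′∉ , l∈W , l~l′ , adjacent-sym p~l ,
      (λ w∈W l~w → third-neighbour l~l′ l′∈W (adjacent-sym p~l) p∈W l′≢p l~w w∈W) , segment
      where
      l′∉ : l′ ∉ₗ _ ∷ p ∷ ps
      l′∉ (here l′≡l) = adjacent⇒≢ l~l′ (sym l′≡l)
      l′∉ (there l′∈) = [ l∉ , l≢r ]′ (segment-inner p ps segment l′∈ l′≢p l∈W (adjacent-sym l~l′))

    segment-rotate : ∀ {W x} p ps q → Segment W x ((p ∷ ps) ∷ʳ q) x → x ∈ W → q ∈ W → q ≢ p →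
                     Segment W q (x ∷ p ∷ ps) q
    segment-rotate p ps q segment@(p∈W , p~x , _) x∈W q∈W q≢p =
      x∈W , x~q , adjacent-sym p~x ,
      (λ w∈W x~w → third-neighbour x~q q∈W (adjacent-sym p~x) p∈W q≢p x~w w∈W) ,
      segment-init (p ∷ ps) q segment
      where
      x~q = adjacent-sym (segment-last (p ∷ ps) q segment)


    BoundsBelow : ℕ → Set₁
    BoundsBelow k = ∀ {W A} n → measure W A < k → A ⊆ W → InPathComponents W A → Bound (Lk W A n) ∣ A ∣ n

    bound-split : ∀ {W A n} u → BoundsBelow (measure W A) → u ∈ W → u ∉ A → A ⊆ W →
                  InPathComponents W A → ReachesEnd W u → Bound (Lk W A n) ∣ A ∣ n
    bound-split {W} {A} {n} u ih u∈W u∉A A⊆W inPaths u-end =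
      Lk-link-deletion u∈W u∉A
        (ih n (measure-delete u∈W u∉A) A⊆W-u (InPathComponents-delete u u∈W inPaths (λ a∈ → a∈) A⊆W-u))
        (ih n (measure-link u∈W u∉A) (∪⁅⁆-⊆ A⊆W u∈W) (InPathComponents-∪⁅⁆ inPaths u-end))
      where
      A⊆W-u : A ⊆ W - u
      A⊆W-u = p⊆q∧x∉p⇒p⊆q-x A⊆W u∉A

    bound-isolated-anchor : ∀ {W A n v} → BoundsBelow (measure W A) → A ⊆ W → InPathComponents W A →
                            v ∈ A → (∀ {u} → u ∈ W → ¬ Adjacent v u) → Bound (Lk W A (suc n)) ∣ A ∣ (suc n)
    bound-isolated-anchor {W} {A} {n} {v} ih A⊆W inPaths v∈A v≁W =
      Bound-peel peel (trans (∣p∣≡1+∣p-x∣ v∈A) (+-comm 1 _)) (s≤s z≤n)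
        (ih n (measure-remove v∈W) A-v⊆W-v (InPathComponents-delete v v∈W inPaths p-x⊆p A-v⊆W-v))
      where
      v∈W = A⊆W v∈A
      A-v⊆W-v : A - v ⊆ W - v
      A-v⊆W-v = p⊆q⇒p-x⊆q-x A⊆W
      peel : Lk W A (suc n) ≅ Lk (W - v) (A - v) n
      peel = subst (λ k → Lk W A k ≅ Lk (W - v) (A - v) n) (+-comm n 1)
               (Lk-peel n (v ∷ []) (λ { (here refl) → v∈A })
                 (λ σ⊆ → ∈∪ʳ v∈A , λ w∈ v~w → v≁W (∪-least (λ x∈ → proj₁ (σ⊆ x∈)) A⊆W w∈) v~w))

    bound-anchor-edge : ∀ {W A n v u} → BoundsBelow (measure W A) → A ⊆ W → InPathComponents W A →
                        v ∈ A → degIn W v ≤ 1 → Adjacent v u → u ∈ A → Bound (Lk W A (suc n)) ∣ A ∣ (suc n)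
    bound-anchor-edge {W} {A} {n} {v} {u} ih A⊆W inPaths v∈A deg≤1 v~u u∈A =
      Bound-peel peel ∣A∣≡ ≤-refl
        (ih n (<-trans (measure-remove u∈W-v) (measure-remove v∈W)) A′⊆W′
           (InPathComponents-delete u u∈W-v (InPathComponents-delete v v∈W inPaths p-x⊆p (p⊆q⇒p-x⊆q-x A⊆W))
              p-x⊆p A′⊆W′))
      where
      v∈W = A⊆W v∈A
      u≢v : u ≢ v
      u≢v u≡v = adjacent⇒≢ v~u (sym u≡v)
      u∈W-v = x∈p-y⁺ (A⊆W u∈A) u≢v
      A′⊆W′ : A - v - u ⊆ W - v - u
      A′⊆W′ = p⊆q⇒p-x⊆q-x (p⊆q⇒p-x⊆q-x A⊆W)
      ∣A∣≡ : ∣ A ∣ ≡ ∣ A - v - u ∣ + 2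
      ∣A∣≡ = trans (∣p∣≡1+∣p-x∣ v∈A) (trans (cong suc (∣p∣≡1+∣p-x∣ (x∈p-y⁺ u∈A u≢v))) (+-comm 2 _))
      peel : Lk W A (suc n) ≅ Lk (W - v - u) (A - v - u) n
      peel = subst (λ k → Lk W A k ≅ Lk (W - v - u) (A - v - u) n) (+-comm n 1)
               (Lk-peel n (v ∷ u ∷ []) (λ { (here refl) → v∈A ; (there (here refl)) → u∈A })
                 (λ σ⊆ → ∈∪ʳ v∈A , v~u ,
                   (λ w∈ v~w → degIn≤1⇒unique deg≤1 v~w (∪-least (λ x∈ → proj₁ (σ⊆ x∈)) A⊆W w∈) v~u (A⊆W u∈A)) , tt))

    closed-cycle-IsCone : ∀ {W A n x} p ps q → Segment W x ((p ∷ ps) ∷ʳ q) x → Unique ((p ∷ ps) ∷ʳ q) →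
                          x ∉ₗ (p ∷ ps) ∷ʳ q → x ∈ W → ((p ∷ ps) ∷ʳ q) ⊆ₗ A → A ⊆ W → x ∉ A →
                          IsCone (Lk W A n) x
    closed-cycle-IsCone {W} {A} {n} {x} p ps q segment unique x∉L x∈W L⊆A A⊆W x∉A η x∉η =
      add-x , Lk-downward ∈∪ˡ
      where
      L = (p ∷ ps) ∷ʳ q
      q∈L : q ∈ₗ L
      q∈L = ∈-++⁺ʳ (p ∷ ps) (here refl)
      q≢p : q ≢ p
      q≢p refl = Unique[x∷xs]⇒x∉xs unique (∈-++⁺ʳ ps (here refl))
      x~q : Adjacent x q
      x~q = adjacent-sym (segment-last (p ∷ ps) q segment)
      Y = η ∪ A
      Y′ = (Y ∪ ⁅ x ⁆) - q
      add-x : Lk W A n η → Lk W A n (η ∪ ⁅ x ⁆)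
      add-x (η⊆ , α<n) =
        ∪⁅⁆-⊆∖ η⊆ x∈W x∉A ,
        subst (α[_]< n) (trans (∪-assoc η A ⁅ x ⁆) (sym (∪⁅⁆-∪-swap η A x)))
          (α<-cone x (p ∷ ps) q x~q peel peel′ rest⊆ α<n)
        where
        Y⊆W : Y ⊆ W
        Y⊆W = ∪-least (λ y∈ → proj₁ (η⊆ y∈)) A⊆W
        x∉Y : x ∉ Y
        x∉Y x∈ = [ x∉η , x∉A ]′ (∈∪⁻ x∈)
        peel : Peelable Y L
        peel = segment⇒peelable L segment unique (λ y∈ → ∈∪ʳ (L⊆A y∈)) Y⊆W x∉Y x∉Y
        rotated⊆Y′ : (x ∷ p ∷ ps) ⊆ₗ Y′
        rotated⊆Y′ (here refl) = x∈p-y⁺ ∈∪⁅⁆ λ { refl → x∉L q∈L }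
        rotated⊆Y′ (there y∈) = x∈p-y⁺ (∈∪ˡ (∈∪ʳ (L⊆A (∈-++⁺ˡ y∈)))) λ { refl → Unique-last unique y∈ }
        peel′ : Peelable Y′ (x ∷ p ∷ ps)
        peel′ = segment⇒peelable (x ∷ p ∷ ps) (segment-rotate p ps q segment x∈W (A⊆W (L⊆A q∈L)) q≢p)
                  (¬Any⇒All¬ _ (λ x∈ → x∉L (∈-++⁺ˡ x∈)) ∷ Unique-init unique) rotated⊆Y′
                  (λ y∈ → ∪⁅⁆-⊆ Y⊆W x∈W (p-x⊆p y∈)) y∉p-y y∉p-y
        rest⊆ : removeAll Y′ (x ∷ p ∷ ps) ⊆ removeAll Y L
        rest⊆ y∈ with removeAll⁻ (x ∷ p ∷ ps) y∈
        ... | y∈Y′ , y∉ with x∈p-y⁻ y∈Y′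
        ...   | y∈Y∪x , y≢q =
          removeAll⁺ L (∈∪⁅⁆⁻ y∈Y∪x (λ y≡x → y∉ (here y≡x)))
            (λ y∈L → [ (λ y∈cs → y∉ (there y∈cs)) , (λ { (here y≡q) → y≢q y≡q }) ]′ (∈-++⁻ (p ∷ ps) y∈L))

    bound-closed-cycle : ∀ {W A n x} p ps q → BoundsBelow (measure W A) → Segment W x ((p ∷ ps) ∷ʳ q) x →
                         Unique ((p ∷ ps) ∷ʳ q) → x ∉ₗ (p ∷ ps) ∷ʳ q → x ∈ W →
                         (∀ {y} → y ∈ A → y ∈ₗ (p ∷ ps) ∷ʳ q) → ((p ∷ ps) ∷ʳ q) ⊆ₗ A → A ⊆ W →
                         Bound (Lk W A n) ∣ A ∣ n
    bound-closed-cycle {W} {A} {n} {x} p ps q ih segment unique x∉L x∈W A⊆L L⊆A A⊆W =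
      Bound-cone x
        (Bound-resp-≅ (≅-sym (deletion-Lk x))
          (ih n (measure-delete x∈W x∉A) (p⊆q∧x∉p⇒p⊆q-x A⊆W x∉A)
            (segment⇒InPathComponents p (ps ∷ʳ q) segment x∉L A⊆L (λ y∈ → A⊆W (L⊆A y∈)))))
        (closed-cycle-IsCone p ps q segment unique x∉L x∈W L⊆A A⊆W x∉A)
      where
      x∉A : x ∉ A
      x∉A x∈A = x∉L (A⊆L x∈A)

    bound-cycle : ∀ {W A n} l p ps r → BoundsBelow (measure W A) → Acc _<_ (measure W A) →
                  (∀ {w} → w ∈ W → 2 ≤ degIn W w) → Segment W l (p ∷ ps) r → Unique (p ∷ ps) →
                  l ∉ₗ p ∷ ps → r ∉ₗ p ∷ ps → l ∈ W → (∀ {x} → x ∈ A → x ∈ₗ p ∷ ps) → (p ∷ ps) ⊆ₗ A → A ⊆ W →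
                  Bound (Lk W A n) ∣ A ∣ n
    bound-cycle {W} {A} {n} l p ps r ih (acc rs) deg≥2 segment unique l∉ r∉ l∈W A⊆ps ps⊆A A⊆W with l ≟ r
    ... | yes refl with initLast ps
    ...   | [] = ⊥-elim (segment-not-loop (deg≥2 (proj₁ segment)) segment)
    ...   | ps′ ∷ʳ′ q = bound-closed-cycle p ps′ q ih segment unique l∉ l∈W A⊆ps ps⊆A A⊆W
    bound-cycle {W} {A} {n} l p ps r ih (acc rs) deg≥2 segment unique l∉ r∉ l∈W A⊆ps ps⊆A A⊆W | no l≢r
      with segment-extend p ps deg≥2 segment l∈W l∉ l≢r
    ...   | l′ , l′∈W , l′∉ , segment′ =
      Lk-link-deletion l∈W l∉A
        (ih n (measure-delete l∈W l∉A) (p⊆q∧x∉p⇒p⊆q-x A⊆W l∉A)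
          (segment⇒InPathComponents p ps segment l∉ A⊆ps (λ y∈ → A⊆W (ps⊆A y∈))))
        (bound-cycle l′ l (p ∷ ps) r (λ n′ lt → ih n′ (<-trans lt (measure-link l∈W l∉A)))
          (rs (measure-link l∈W l∉A)) deg≥2 segment′ (¬Any⇒All¬ _ l∉ ∷ unique) l′∉ r∉′ l′∈W
          A∪l⊆ l∷ps⊆ (∪⁅⁆-⊆ A⊆W l∈W))
      where
      l∉A : l ∉ A
      l∉A l∈A = l∉ (A⊆ps l∈A)
      r∉′ : r ∉ₗ l ∷ p ∷ ps
      r∉′ (here r≡l) = l≢r (sym r≡l)
      r∉′ (there r∈) = r∉ r∈
      A∪l⊆ : ∀ {x} → x ∈ A ∪ ⁅ l ⁆ → x ∈ₗ l ∷ p ∷ ps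
      A∪l⊆ x∈ = [ (λ x∈A → there (A⊆ps x∈A)) , (λ x∈l → here (∈⁅⁆⁻ x∈l)) ]′ (∈∪⁻ x∈)
      l∷ps⊆ : (l ∷ p ∷ ps) ⊆ₗ (A ∪ ⁅ l ⁆)
      l∷ps⊆ (here refl) = ∈∪⁅⁆
      l∷ps⊆ (there y∈) = ∈∪ˡ (ps⊆A y∈)

    bound-cycles : ∀ {W A n} → BoundsBelow (measure W A) → A ⊆ W → (∀ {w} → w ∈ W → 2 ≤ degIn W w) →
                   (∀ {a} → a ∉ A) → Bound (Lk W A (suc n)) ∣ A ∣ (suc n)
    bound-cycles {W} {A} {n} ih A⊆W deg≥2 A-empty with nonempty? W
    ... | no W-empty = bound-empty W-empty A⊆W
    ... | yes (v , v∈W) with two-neighbours (deg≥2 v∈W)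
    ...   | l , r , v~l , l∈W , v~r , r∈W , l≢r =
      Lk-link-deletion v∈W A-empty
        (ih (suc n) (measure-delete v∈W A-empty) (λ a∈ → ⊥-elim (A-empty a∈)) (λ a∈ → ⊥-elim (A-empty a∈)))
        (bound-cycle l v [] r (λ n′ lt → ih n′ (<-trans lt (measure-link v∈W A-empty))) (<-wellFounded _) deg≥2
          segment ([] ∷ []) l∉ r∉ l∈W A∪v⊆ (λ { (here refl) → ∈∪⁅⁆ }) (∪⁅⁆-⊆ A⊆W v∈W))
      where
      segment : Segment W l (v ∷ []) r
      segment = v∈W , v~l , v~r , (λ w∈W v~w → third-neighbour v~l l∈W v~r r∈W l≢r v~w w∈W) , tt
      l∉ : l ∉ₗ v ∷ []
      l∉ (here l≡v) = adjacent⇒≢ v~l (sym l≡v)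
      r∉ : r ∉ₗ v ∷ []
      r∉ (here r≡v) = adjacent⇒≢ v~r (sym r≡v)
      A∪v⊆ : ∀ {x} → x ∈ A ∪ ⁅ v ⁆ → x ∈ₗ v ∷ []
      A∪v⊆ x∈ = [ (λ x∈A → ⊥-elim (A-empty x∈A)) , (λ x∈v → here (∈⁅⁆⁻ x∈v)) ]′ (∈∪⁻ x∈)

    bound-step : ∀ {W A} n → BoundsBelow (measure W A) → A ⊆ W → InPathComponents W A → Bound (Lk W A n) ∣ A ∣ n
    bound-step zero _ _ _ = Void⇒Bound Lk-void
    bound-step {W} {A} (suc n) ih A⊆W inPaths with end? W
    ... | no no-end = bound-cycles ih A⊆W deg≥2 A-empty
      where
      deg≥2 : ∀ {w} → w ∈ W → 2 ≤ degIn W w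
      deg≥2 w∈W = ≰⇒> λ deg≤1 → no-end (_ , w∈W , deg≤1)
      A-empty : ∀ {a} → a ∉ A
      A-empty a∈A with inPaths a∈A
      ... | w , _ , w∈W , deg≤1 = no-end (w , w∈W , deg≤1)
    ... | yes (w , w∈W , deg≤1) with w ∈? A
    ...   | no w∉A = bound-split w ih w∈W w∉A A⊆W inPaths (w , stop , w∈W , deg≤1)
    ...   | yes w∈A with neighbour? W w
    ...     | no isolated = bound-isolated-anchor ih A⊆W inPaths w∈A (λ u∈W w~u → isolated (_ , u∈W , w~u))
    ...     | yes (u , u∈W , w~u) with u ∈? A
    ...       | yes u∈A = bound-anchor-edge ih A⊆W inPaths w∈A deg≤1 w~u u∈A
    ...       | no u∉A = bound-split u ih u∈W u∉A A⊆W inPaths (w , step stop (adjacent-sym w~u) w∈W , w∈W , deg≤1)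

    bounds-below : ∀ {k} → Acc _<_ k → BoundsBelow k
    bounds-below (acc rs) n lt = bound-step n (bounds-below (rs lt))

    Lk-bound : ∀ {W A} n → A ⊆ W → InPathComponents W A → Bound (Lk W A n) ∣ A ∣ n
    Lk-bound {W} {A} n = bound-step n (bounds-below (<-wellFounded (measure W A)))

proposition5p3 : ∀ {N : ℕ} (G : Graph N) (n : ℕ) → MaxDegreeAtMost2 G → 1 ≤ n →
    (A : Subset N) → Independent G A → ∣ A ∣ ≤ n ∸ 1 →
    (∀ v → v ∈ A → ComponentIsPath G v) →
    CollapsibilityAtMost (lk (I G n) A) (2 * (n ∸ 1) ∸ ∣ A ∣)
proposition5p3 G (suc k) deg≤2 _ A _ ∣A∣≤k paths =
  2 * k ∸ ∣ A ∣ , ≤-refl ,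
  Collapsible-resp-≅ (Lk-⊤≅lk G)
    (collapsible (Lk-bound G deg≤2 (suc k) (λ _ → ∈⊤) (λ a∈ → pathComponent⇒ReachesEnd G (paths _ a∈)))
                 (2 * k ∸ ∣ A ∣) (≤-reflexive 2+2k≡))
  where
  2+2k≡ : suc k + suc k ≡ 2 + (2 * k ∸ ∣ A ∣ + ∣ A ∣)
  2+2k≡ = begin
    suc k + suc k             ≡⟨ cong suc (+-suc k k) ⟩
    2 + (k + k)               ≡⟨ cong (λ m → 2 + (k + m)) (sym (+-identityʳ k)) ⟩
    2 + 2 * k                 ≡⟨ cong (2 +_) (sym (m∸n+n≡m (≤-trans ∣A∣≤k (m≤m+n k (k + 0))))) ⟩
    2 + (2 * k ∸ ∣ A ∣ + ∣ A ∣) ∎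
    where open ≡-Reasoning
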